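{- Let $\pi=a_1a_2\cdots a_n$ be a full permutation of $[n]$ with $n\ge 2$, and let $M$ be the top-level meld produced by left bracketing of $\pi$. If $M$ has the form $[m_1,m_2]$, then $\pi$ is indecomposable (so $\pi=\pi_1$ is its only indecomposable component). Otherwise $\pi$ is decomposable, $M$ has the form $(m_1,m_2)$, and $m_2$ is the rightmost indecomposable component $\pi_q$ of $\pi$ (i.e. the word formed by the entries of $m_2$ in order is $\pi_q$), with $m_2$ being its left bracketing.
   Context: $[n]=\{1,\dots,n\}$; one-line notation. The permutation matrix of $\pi$ has a $1$ in row $n+1-a_j$, column $j$. Bootstrap percolation: a cell is mutable if it contains $0$ and at least two orthogonal neighbours contain $1$; mutable cells are changed to $1$ one at a time until none remain (final configuration independent of order); $\pi$ is full if the final configuration is the all-ones matrix. A permutation of $[k]$ is indecomposable if it maps no proper initial segment $\{1,\dots,j\}$, $1\le j<k$, onto itself; a word of distinct integers is indecomposable if its reduced form (replace the $i$-th smallest entry by $i$) is. Indecomposable components: $\pi=\pi_1\cdots\pi_q$ (concatenation) where $\pi_1$ is the longest indecomposable prefix of $\pi$ and the remaining components are obtained recursively from the rest of the word. Melds: each $a_j$ (at position $j$) is a meld with entry set $\{a_j\}$; melds $m_1,m_2$ occupying adjacent position intervals, $m_1$ left of $m_2$, with entry sets $E_1,E_2$ whose union is a set of consecutive integers, are mergeable, with merger $(m_1,m_2)$ if $\max E_1+1=\min E_2$ and $[m_1,m_2]$ if $\min E_1=\max E_2+1$. Left bracketing: start from singleton melds $a_1,\dots,a_n$ and repeatedly merge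 the leftmost adjacent mergeable pair until none remains; for a full $\pi$ with $n\ge2$ it ends in a single meld $M$ of the form $(m_1,m_2)$ or $[m_1,m_2]$ (the top-level left bracketing). The left bracketing of a word of distinct integers is defined in the same way. -}

module Defs where

open import Data.Nat using (ℕ; zero; suc; _+_; _∸_; _≤_; _<_; _⊔_; _⊓_; _≡ᵇ_; _<ᵇ_)
open import Data.Bool using (Bool; true; false; if_then_else_; _∧_)
open import Data.List using (List; []; _∷_; _++_; map; foldr; length; upTo; take; filter)
open import Data.Bool.ListAction using (all; any)
open import Data.Maybe using (Maybe; just; nothing)
import Data.Maybe as Maybe
open import Data.Product using (_×_; Σ; _,_)
open import Data.List.Membership.Propositional using (_∈_)
open import Relation.Binary.PropositionalEquality using (_≡_; _≢_)
open import Relation.Nullary using (¬_)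
open import Function.Bundles using (_⇔_)

-- Permutations as one-line words a₁ a₂ ⋯ aₙ (lists of naturals).

oneTo : ℕ → List ℕ
oneTo n = map suc (upTo n)

-- At w j a : the entry at (1-based) position j of w is a.
data At : List ℕ → ℕ → ℕ → Set where
  here  : ∀ {a w} → At (a ∷ w) 1 a
  there : ∀ {a b w j} → At w j b → At (a ∷ w) (suc j) b

-- Bootstrap percolation on the permutation matrix.
-- Cells are (row , column), 1 ≤ row, column ≤ n.

data Adj : ℕ → ℕ → ℕ → ℕ → Set where
  up    : ∀ {r c} → Adj r c (suc r) c
  down  : ∀ {r c} → Adj (suc r) c r c
  right : ∀ {r c} → Adj r c r (suc c)
  left  : ∀ {r c} → Adj r (suc c) r c

-- Infected n π r c : cell (r , c) contains 1 in the final configuration,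
-- i.e. the least set of cells containing the initial 1's (row n+1-aⱼ,
-- column j) and closed under the rule "a cell in the grid with at least
-- two (distinct) orthogonal neighbours containing 1 becomes 1".
data Infected (n : ℕ) (π : List ℕ) : ℕ → ℕ → Set where
  seed   : ∀ {j a} → At π j a → Infected n π (suc n ∸ a) j
  spread : ∀ {r c} r₁ c₁ r₂ c₂ →
           1 ≤ r → r ≤ n → 1 ≤ c → c ≤ n →
           Adj r c r₁ c₁ → Adj r c r₂ c₂ →
           ¬ (r₁ ≡ r₂ × c₁ ≡ c₂) →
           Infected n π r₁ c₁ → Infected n π r₂ c₂ →
           Infected n π r c

Full : ℕ → List ℕ → Set
Full n π = ∀ r c → 1 ≤ r → r ≤ n → 1 ≤ c → c ≤ n → Infected n π r c

reduce : List ℕ → List ℕ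
reduce w = map (λ x → suc (length (filter (λ y → y Data.Nat.<? x) w))) w

Indecomposable : List ℕ → Set
Indecomposable w =
  ∀ j → 1 ≤ j → j < length w →
  ¬ (∀ x → (x ∈ take j (reduce w)) ⇔ (1 ≤ x × x ≤ j))

record LongestIndecPrefix (w p rest : List ℕ) : Set where
  field
    split    : w ≡ p ++ rest
    nonempty : 1 ≤ length p
    indec    : Indecomposable p
    longest  : ∀ k → length p < k → k ≤ length w → ¬ Indecomposable (take k w)

data Components : List ℕ → List (List ℕ) → Set where
  done : Components [] []
  next : ∀ {w p rest cs} → LongestIndecPrefix w p rest →
         Components rest cs → Components w (p ∷ cs)

data Meld : Set where
  leaf  : ℕ → Meld
  paren : Meld → Meld → Meld
  brack : Meld → Meld → Meld

entries : Meld → List ℕ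
entries (leaf a)    = a ∷ []
entries (paren m k) = entries m ++ entries k
entries (brack m k) = entries m ++ entries k

maxL : List ℕ → ℕ
maxL = foldr _⊔_ 0

minL : List ℕ → ℕ
minL []       = 0
minL (x ∷ xs) = foldr _⊓_ x xs

consecutive : List ℕ → Bool
consecutive S =
  all (λ k → any (k ≡ᵇ_) S) (map (minL S +_) (upTo (suc (maxL S) ∸ minL S)))

merge? : Meld → Meld → Maybe Meld
merge? m₁ m₂ =
  if consecutive (entries m₁ ++ entries m₂)
  then (if suc (maxL (entries m₁)) ≡ᵇ minL (entries m₂) then just (paren m₁ m₂)
        else if minL (entries m₁) ≡ᵇ suc (maxL (entries m₂)) then just (brack m₁ m₂)
        else nothing)
  else nothing

step : List Meld → Maybe (List Meld)
step []               = nothing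
step (m ∷ [])         = nothing
step (m₁ ∷ m₂ ∷ ms) = stepAt (merge? m₁ m₂) (step (m₂ ∷ ms))
  where
  stepAt : Maybe Meld → Maybe (List Meld) → Maybe (List Meld)
  stepAt (just m) _   = just (m ∷ ms)
  stepAt nothing rest = Maybe.map (m₁ ∷_) rest

-- repeat until no mergeable pair remains (fuel suffices: each step
-- decreases the number of melds)
iterateSteps : ℕ → List Meld → List Meld
iterateSteps zero    ms = ms
iterateSteps (suc k) ms with step ms
... | nothing  = ms
... | just ms′ = iterateSteps k ms′

leftBracketing : List ℕ → List Meld
leftBracketing w = iterateSteps (length w) (map leaf w)

-- The last merge of the left bracketing joins two melds a and b, and π is the word of a followed
-- by the word of b. If it is a bracket, every entry of a exceeds every entry of b; then no proper
-- prefix of reduce π is an initial segment {1..j}: a prefix inside a misses the value 1 (some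
-- entry of b is smaller), and a prefix containing all of a contains the rank |π| of the maximum
-- of a. If it is a parenthesis, the entries of a are exactly 1..|a|, so π decomposes there, and b
-- is the last component once its word is indecomposable. Either b is a single entry, or
-- b = [a′, b′], indecomposable as above, or b = (a′, b′); in that last case the entries of a and a′
-- form a block of consecutive integers with max a + 1 = min a′, so a and a′ were mergeable when b
-- was formed, and the leftmost rule would have merged them instead.
module Submission where

open import Defs
open import Data.Bool using (T; true; false)
open import Data.Bool.ListAction using (any)
open import Data.Bool.Properties using (T-≡)
open import Data.List using (List; []; _∷_; _++_; map; length; upTo; filter; take; drop; concat; concatMap)
open import Data.List.Membership.Propositional using (_∈_)
open import Data.List.Membership.Propositional.Properties
  using (∈-map⁻; ∈-map⁺; ∈-++⁺ˡ; ∈-++⁺ʳ; ∈-++⁻; ∈-upTo⁻; ∈-upTo⁺)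
open import Data.List.Properties
  using ( foldr-preservesᵇ; foldr-preservesᵒ; length-++; length-++-≤ˡ; length-map; length-upTo
        ; length-take; length-filter; ++-assoc; ++-identityʳ; ∷-injectiveʳ; map-++; map-cong-local
        ; concat-++; concatMap-map; concatMap-pure; take-map; take-all; take++drop≡id
        ; filter-++; filter-none; filter-all; filter-notAll; filter-accept; filter-reject )
open import Data.List.Relation.Binary.Permutation.Propositional using (_↭_; ↭-sym; ↭⇒↭ₛ)
open import Data.List.Relation.Binary.Permutation.Propositional.Properties using (∈-resp-↭; ↭-length)
import Data.List.Relation.Binary.Permutation.Setoid.Properties as PermutationSetoid
import Data.List.Relation.Unary.All as All
open import Data.List.Relation.Unary.All.Properties using (all⁻; ++⁻ˡ)
open import Data.List.Relation.Unary.AllPairs using ([]; _∷_)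
open import Data.List.Relation.Unary.Any using (here; there)
import Data.List.Relation.Unary.Any as Any
open import Data.List.Relation.Unary.Any.Properties using (any⁺)
open import Data.List.Relation.Unary.Unique.Propositional using (Unique)
import Data.List.Relation.Unary.Unique.Propositional.Properties as Unique
open import Data.Maybe using (just; nothing)
import Data.Maybe as Maybe
open import Data.Nat
  using (ℕ; zero; suc; _+_; _∸_; _≤_; _<_; _≤′_; ≤′-refl; ≤′-step; _⊔_; _⊓_; _≡ᵇ_; z≤n; s≤s; s≤s⁻¹)
open import Data.Nat.Induction using (<-wellFounded)
open import Data.Nat.Properties
open import Data.List.Membership.DecPropositional _≟_ using (_∈?_)
open import Data.Product using (Σ; _×_; _,_; proj₁; proj₂)
open import Data.Sum using (_⊎_; inj₁; inj₂; [_,_]; [_,_]′)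
open import Function using (_∘_; _on_; flip; _⇔_; mk⇔; Equivalence)
open import Induction.WellFounded using (Acc; acc)
open import Relation.Binary.Construct.Closure.ReflexiveTransitive using (Star; ε; _◅_)
import Relation.Binary.Construct.On as On
open import Relation.Binary.Definitions using (tri<; tri≈; tri>)
open import Relation.Binary.PropositionalEquality hiding ([_])
open import Relation.Nullary using (¬_; Dec; yes; no; ¬?; contradiction)
open import Relation.Nullary.Decidable using (map′; _×-dec_; _→-dec_)
open import Relation.Unary using (Decidable)

-- Extremes, blocks and consecutive entries

maxL-ub : ∀ {x} w → x ∈ w → x ≤ maxL w
maxL-ub {x} w x∈w = foldr-preservesᵒ ≤⊔ 0 w (inj₂ (Any.map ≤-reflexive x∈w))
  where
  ≤⊔ : ∀ m n → x ≤ m ⊎ x ≤ n → x ≤ m ⊔ n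
  ≤⊔ m n = [ m≤n⇒m≤n⊔o n , m≤n⇒m≤o⊔n m ]

maxL-∈ : ∀ w → 1 ≤ length w → maxL w ∈ w
maxL-∈ (y ∷ [])    _ = here (⊔-identityʳ y)
maxL-∈ (y ∷ z ∷ w) _ =
  [ here , (λ eq → there (Any.map (trans eq) (maxL-∈ (z ∷ w) (s≤s z≤n)))) ]′
    (⊔-sel y (maxL (z ∷ w)))

minL-lb : ∀ {x} w → x ∈ w → minL w ≤ x
minL-lb {x} (y ∷ w) x∈ = foldr-preservesᵒ ⊓≤ y w (Any.toSum (Any.map (≤-reflexive ∘ sym) x∈))
  where
  ⊓≤ : ∀ m n → m ≤ x ⊎ n ≤ x → m ⊓ n ≤ x
  ⊓≤ m n = [ m≤n⇒m⊓o≤n n , m≤n⇒o⊓m≤n m ]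

minL-∈ : ∀ w → 1 ≤ length w → minL w ∈ w
minL-∈ (y ∷ w) _ = foldr-preservesᵇ ⊓-∈ (here refl) (All.tabulate there)
  where
  ⊓-∈ : ∀ {m n} → m ∈ y ∷ w → n ∈ y ∷ w → m ⊓ n ∈ y ∷ w
  ⊓-∈ {m} {n} m∈ n∈ with ⊓-sel m n
  ... | inj₁ m⊓n≡m = subst (_∈ y ∷ w) (sym m⊓n≡m) m∈
  ... | inj₂ m⊓n≡n = subst (_∈ y ∷ w) (sym m⊓n≡n) n∈

minL-glb : ∀ {m} w → 1 ≤ length w → (∀ {x} → x ∈ w → m ≤ x) → m ≤ minL w
minL-glb (y ∷ w) _ m≤ = foldr-preservesᵇ ⊓-glb (m≤ (here refl)) (All.tabulate (m≤ ∘ there))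

minL≤maxL : ∀ w → 1 ≤ length w → minL w ≤ maxL w
minL≤maxL w 1≤w = maxL-ub w (minL-∈ w 1≤w)

infix 4 _≪_

_≪_ : List ℕ → List ℕ → Set
u ≪ v = ∀ {x y} → x ∈ u → y ∈ v → x < y

≪-from-gap : ∀ u v → suc (maxL u) ≡ minL v → u ≪ v
≪-from-gap u v gap x∈u y∈v =
  ≤-trans (s≤s (maxL-ub u x∈u)) (≤-trans (≤-reflexive gap) (minL-lb v y∈v))

≪-++ˡ : ∀ u v {w} → u ≪ w → v ≪ w → u ++ v ≪ w
≪-++ˡ u v u≪w v≪w x∈ y∈w with ∈-++⁻ u x∈
... | inj₁ x∈u = u≪w x∈u y∈w
... | inj₂ x∈v = v≪w x∈v y∈w

minL-++-≪ : ∀ u v → 1 ≤ length u → u ≪ v → minL (u ++ v) ≡ minL u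
minL-++-≪ u v 1≤u u≪v =
  ≤-antisym (minL-lb (u ++ v) (∈-++⁺ˡ (minL-∈ u 1≤u)))
            (minL-glb (u ++ v) (≤-trans 1≤u (length-++-≤ˡ u)) minL-u≤)
  where
  minL-u≤ : ∀ {x} → x ∈ u ++ v → minL u ≤ x
  minL-u≤ x∈ with ∈-++⁻ u x∈
  ... | inj₁ x∈u = minL-lb u x∈u
  ... | inj₂ x∈v = <⇒≤ (u≪v (minL-∈ u 1≤u) x∈v)

Convex : List ℕ → Set
Convex w = ∀ {x y z} → x ∈ w → z ∈ w → x ≤ y → y ≤ z → y ∈ w

Convex-++ˡ : ∀ u v → Convex (u ++ v) → u ≪ v → Convex u
Convex-++ˡ u v conv u≪v x∈u z∈u x≤y y≤z
  with ∈-++⁻ u (conv (∈-++⁺ˡ x∈u) (∈-++⁺ˡ z∈u) x≤y y≤z)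
... | inj₁ y∈u = y∈u
... | inj₂ y∈v = contradiction y≤z (<⇒≱ (u≪v z∈u y∈v))

Convex-resp-↭ : ∀ {u v} → u ↭ v → Convex v → Convex u
Convex-resp-↭ u↭v conv x∈u z∈u x≤y y≤z =
  ∈-resp-↭ (↭-sym u↭v) (conv (∈-resp-↭ u↭v x∈u) (∈-resp-↭ u↭v z∈u) x≤y y≤z)

consecutive-convex : ∀ w → 1 ≤ length w → Convex w → consecutive w ≡ true
consecutive-convex w 1≤w conv = Equivalence.to T-≡ (all⁻ _ (All.tabulate k∈w))
  where
  lo = minL w
  hi = maxL w
  k∈w : ∀ {k} → k ∈ map (lo +_) (upTo (suc hi ∸ lo)) → T (any (k ≡ᵇ_) w)
  k∈w k∈ with ∈-map⁻ (lo +_) k∈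
  ... | i , i∈ , refl =
    any⁺ _ (Any.map (≡⇒≡ᵇ _ _)
      (conv (minL-∈ w 1≤w) (maxL-∈ w 1≤w) (m≤m+n lo i) (s≤s⁻¹ lo+i<1+hi)))
    where
    lo+i<1+hi : lo + i < suc hi
    lo+i<1+hi = ≤-trans (+-monoʳ-< lo (∈-upTo⁻ i∈))
                        (≤-reflexive (m+[n∸m]≡n (m≤n⇒m≤1+n (minL≤maxL w 1≤w))))

∈-oneTo⁻ : ∀ {n x} → x ∈ oneTo n → 1 ≤ x × x ≤ n
∈-oneTo⁻ x∈ with ∈-map⁻ suc x∈
... | i , i∈ , refl = s≤s z≤n , ∈-upTo⁻ i∈

∈-oneTo⁺ : ∀ {n x} → 1 ≤ x → x ≤ n → x ∈ oneTo n
∈-oneTo⁺ {x = suc i} _ i<n = ∈-map⁺ suc (∈-upTo⁺ i<n)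

Convex-oneTo : ∀ n → Convex (oneTo n)
Convex-oneTo n x∈ z∈ x≤y y≤z =
  ∈-oneTo⁺ (≤-trans (proj₁ (∈-oneTo⁻ x∈)) x≤y) (≤-trans y≤z (proj₂ (∈-oneTo⁻ z∈)))

Unique-oneTo : ∀ n → Unique (oneTo n)
Unique-oneTo n = Unique.map⁺ suc-injective (Unique.upTo⁺ n)

length-oneTo : ∀ n → length (oneTo n) ≡ n
length-oneTo n = trans (length-map suc (upTo n)) (length-upTo n)

Unique-resp-↭ : ∀ {u v : List ℕ} → u ↭ v → Unique u → Unique v
Unique-resp-↭ u↭v = PermutationSetoid.Unique-resp-↭ (setoid ℕ) (↭⇒↭ₛ u↭v)

Unique-++ˡ : ∀ (u : List ℕ) {v} → Unique (u ++ v) → Unique u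
Unique-++ˡ []      _         = []
Unique-++ˡ (x ∷ u) (x∉ ∷ uu) = ++⁻ˡ u x∉ ∷ Unique-++ˡ u uu

Unique-++ʳ : ∀ (u : List ℕ) {v} → Unique (u ++ v) → Unique v
Unique-++ʳ []      uu       = uu
Unique-++ʳ (x ∷ u) (_ ∷ uu) = Unique-++ʳ u uu

-- Ranks and indecomposability

countBelow : ℕ → List ℕ → ℕ
countBelow x w = length (filter (_<? x) w)

-- reduce w is definitionally map (rank w) w.
rank : List ℕ → ℕ → ℕ
rank w x = suc (countBelow x w)

countBelow-++ : ∀ x u v → countBelow x (u ++ v) ≡ countBelow x u + countBelow x v
countBelow-++ x u v = trans (cong length (filter-++ (_<? x) u v)) (length-++ (filter (_<? x) u))

countBelow-none : ∀ {x} w → (∀ {y} → y ∈ w → x ≤ y) → countBelow x w ≡ 0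
countBelow-none {x} w x≤ = cong length (filter-none (_<? x) (All.tabulate (≤⇒≯ ∘ x≤)))

countBelow-all : ∀ {x} w → (∀ {y} → y ∈ w → y < x) → countBelow x w ≡ length w
countBelow-all {x} w <x = cong length (filter-all (_<? x) (All.tabulate <x))

countBelow-< : ∀ {x} w → x ∈ w → countBelow x w < length w
countBelow-< {x} w x∈w = filter-notAll (_<? x) w (Any.map (λ { refl → <-irrefl refl }) x∈w)

countBelow-∷-< : ∀ {x z} w → z < x → countBelow x (z ∷ w) ≡ suc (countBelow x w)
countBelow-∷-< {x} w z<x = cong length (filter-accept (_<? x) z<x)

countBelow-∷-≮ : ∀ {x z} w → ¬ z < x → countBelow x (z ∷ w) ≡ countBelow x w
countBelow-∷-≮ {x} w z≮x = cong length (filter-reject (_<? x) z≮x)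

countBelow-mono : ∀ {x y} w → x ≤ y → countBelow x w ≤ countBelow y w
countBelow-mono []      _   = z≤n
countBelow-mono {x} {y} (z ∷ w) x≤y with z <? x | z <? y
... | yes z<x | yes z<y
  rewrite countBelow-∷-< w z<x | countBelow-∷-< w z<y = s≤s (countBelow-mono w x≤y)
... | yes z<x | no z≮y = contradiction (<-≤-trans z<x x≤y) z≮y
... | no z≮x  | yes z<y
  rewrite countBelow-∷-≮ w z≮x | countBelow-∷-< w z<y = m≤n⇒m≤1+n (countBelow-mono w x≤y)
... | no z≮x  | no z≮y
  rewrite countBelow-∷-≮ w z≮x | countBelow-∷-≮ w z≮y = countBelow-mono w x≤y

countBelow-strict : ∀ {x y} w → x ∈ w → x < y → countBelow x w < countBelow y w
countBelow-strict {x} {y} (z ∷ w) (here refl) x<y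
  rewrite countBelow-∷-≮ w (<-irrefl {z} refl) | countBelow-∷-< w x<y =
  s≤s (countBelow-mono w (<⇒≤ x<y))
countBelow-strict {x} {y} (z ∷ w) (there x∈w) x<y with z <? x | z <? y
... | yes z<x | yes z<y
  rewrite countBelow-∷-< w z<x | countBelow-∷-< w z<y = s≤s (countBelow-strict w x∈w x<y)
... | yes z<x | no z≮y = contradiction (<-trans z<x x<y) z≮y
... | no z≮x  | yes z<y
  rewrite countBelow-∷-≮ w z≮x | countBelow-∷-< w z<y = m≤n⇒m≤1+n (countBelow-strict w x∈w x<y)
... | no z≮x  | no z≮y
  rewrite countBelow-∷-≮ w z≮x | countBelow-∷-≮ w z≮y = countBelow-strict w x∈w x<y

countBelow-onto : ∀ w → Unique w → ∀ t → t < length w → Σ ℕ λ x → x ∈ w × countBelow x w ≡ t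
countBelow-onto (z ∷ w) (z∉w ∷ uw) t t<len with <-cmp t (countBelow z w)
... | tri≈ _ t≡c _ = z , here refl , trans (countBelow-∷-≮ w (<-irrefl refl)) (sym t≡c)
... | tri< t<c _ _ with countBelow-onto w uw t (<-≤-trans t<c (length-filter (_<? z) w))
...   | x , x∈w , cx≡t = x , there x∈w , trans (countBelow-∷-≮ w z≮x) cx≡t
  where
  z≮x : ¬ z < x
  z≮x z<x = <⇒≱ t<c (subst (countBelow z w ≤_) cx≡t (countBelow-mono w (<⇒≤ z<x)))
countBelow-onto (z ∷ w) (z∉w ∷ uw) (suc t) t<len | tri> _ _ c<t
  with countBelow-onto w uw t (s≤s⁻¹ t<len)
...   | x , x∈w , cx≡t = x , there x∈w , trans (countBelow-∷-< w z<x) (cong suc cx≡t)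
  where
  z<x : z < x
  z<x with <-cmp z x
  ... | tri< z<x _ _ = z<x
  ... | tri≈ _ z≡x _ = contradiction z≡x (All.lookup z∉w x∈w)
  ... | tri> _ _ x<z =
    contradiction (s≤s⁻¹ c<t) (<⇒≱ (subst (_< countBelow z w) cx≡t (countBelow-strict w x∈w x<z)))

∈-reduce⇔ : ∀ {x} w → Unique w → (x ∈ reduce w) ⇔ (1 ≤ x × x ≤ length w)
∈-reduce⇔ w uw = mk⇔ to from
  where
  to : ∀ {x} → x ∈ reduce w → 1 ≤ x × x ≤ length w
  to x∈ with ∈-map⁻ (rank w) x∈
  ... | y , y∈w , refl = s≤s z≤n , countBelow-< w y∈w
  from : ∀ {x} → 1 ≤ x × x ≤ length w → x ∈ reduce w
  from {suc t} (_ , t<len) with countBelow-onto w uw t t<len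
  ... | y , y∈w , refl = ∈-map⁺ (rank w) y∈w

rank-++-below : ∀ {x} u v → (∀ {y} → y ∈ v → x ≤ y) → rank (u ++ v) x ≡ rank u x
rank-++-below {x} u v x≤v = cong suc (begin
  countBelow x (u ++ v)            ≡⟨ countBelow-++ x u v ⟩
  countBelow x u + countBelow x v  ≡⟨ cong (countBelow x u +_) (countBelow-none v x≤v) ⟩
  countBelow x u + 0               ≡⟨ +-identityʳ _ ⟩
  countBelow x u                   ∎)
  where open ≡-Reasoning

rank-++-above : ∀ {x} u v → (∀ {y} → y ∈ v → y < x) → rank (u ++ v) x ≡ rank u x + length v
rank-++-above {x} u v v<x =
  cong suc (trans (countBelow-++ x u v) (cong (countBelow x u +_) (countBelow-all v v<x)))

take-++ : ∀ {A : Set} k (u v : List A) → take k (u ++ v) ≡ take k u ++ take (k ∸ length u) v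
take-++ zero    []      v = refl
take-++ (suc k) []      v = refl
take-++ zero    (x ∷ u) v = refl
take-++ (suc k) (x ∷ u) v = cong (x ∷_) (take-++ k u v)

take-++-≤ : ∀ {A : Set} {k} (u v : List A) → k ≤ length u → take k (u ++ v) ≡ take k u
take-++-≤ {k = k} u v k≤u = begin
  take k (u ++ v)                    ≡⟨ take-++ k u v ⟩
  take k u ++ take (k ∸ length u) v  ≡⟨ cong (λ i → take k u ++ take i v) (m≤n⇒m∸n≡0 k≤u) ⟩
  take k u ++ []                     ≡⟨ ++-identityʳ (take k u) ⟩
  take k u                           ∎
  where open ≡-Reasoning

take-++-≥ : ∀ {A : Set} {k} (u v : List A) → length u ≤ k →
            take k (u ++ v) ≡ u ++ take (k ∸ length u) v
take-++-≥ {k = k} u v u≤k = trans (take-++ k u v) (cong (_++ take (k ∸ length u) v) (take-all k u u≤k))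

∈-take⁻ : ∀ {A : Set} {x : A} k w → x ∈ take k w → x ∈ w
∈-take⁻ {x = x} k w x∈ = subst (x ∈_) (take++drop≡id k w) (∈-++⁺ˡ x∈)

Indecomposable-short : ∀ w → length w ≤ 1 → Indecomposable w
Indecomposable-short w w≤1 j 1≤j j<w _ = <⇒≱ (≤-<-trans 1≤j j<w) w≤1

¬Indecomposable-++-below : ∀ u v → 1 ≤ length u → 1 ≤ length v → Unique u → u ≪ v →
                           ¬ Indecomposable (u ++ v)
¬Indecomposable-++-below u v 1≤u 1≤v uu u≪v indec = indec (length u) 1≤u u<u++v splits
  where
  u<u++v : length u < length (u ++ v)
  u<u++v = subst (length u <_) (sym (length-++ u)) (m<m+n (length u) 1≤v)
  prefix : take (length u) (reduce (u ++ v)) ≡ reduce u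
  prefix = begin
    take (length u) (map (rank (u ++ v)) (u ++ v))
      ≡⟨ take-map (length u) (u ++ v) ⟩
    map (rank (u ++ v)) (take (length u) (u ++ v))
      ≡⟨ cong (map (rank (u ++ v))) (trans (take-++-≤ u v ≤-refl) (take-all (length u) u ≤-refl)) ⟩
    map (rank (u ++ v)) u
      ≡⟨ map-cong-local (All.tabulate λ x∈u → rank-++-below u v (<⇒≤ ∘ u≪v x∈u)) ⟩
    map (rank u) u
      ∎
    where open ≡-Reasoning
  splits : ∀ x → (x ∈ take (length u) (reduce (u ++ v))) ⇔ (1 ≤ x × x ≤ length u)
  splits x rewrite prefix = ∈-reduce⇔ u uu

Indecomposable-++-above : ∀ u v → 1 ≤ length u → 1 ≤ length v → Unique u → v ≪ u →
                          Indecomposable (u ++ v)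
Indecomposable-++-above u v 1≤u 1≤v uu v≪u j 1≤j j<u++v splits
  rewrite take-map {f = rank (u ++ v)} j (u ++ v) with j ≤? length u
... | yes j≤u with ∈-map⁻ (rank (u ++ v)) (Equivalence.from (splits 1) (≤-refl , 1≤j))
...   | x , x∈ , 1≡rank = <⇒≢ 1<rank 1≡rank
  where
  x∈u : x ∈ u
  x∈u = ∈-take⁻ j u (subst (x ∈_) (take-++-≤ u v j≤u) x∈)
  1<rank : 1 < rank (u ++ v) x
  1<rank = begin-strict
    1                    <⟨ s≤s (≤-trans 1≤v (m≤n+m (length v) (countBelow x u))) ⟩
    rank u x + length v  ≡⟨ rank-++-above u v (λ y∈v → v≪u y∈v x∈u) ⟨
    rank (u ++ v) x      ∎
    where open ≤-Reasoning
Indecomposable-++-above u v 1≤u 1≤v uu v≪u j 1≤j j<u++v splits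
  | no j≰u with ∈-map⁻ (rank u) (Equivalence.from (∈-reduce⇔ u uu) (1≤u , ≤-refl))
...   | x , x∈u , |u|≡rank = <⇒≱ j<u++v (begin
  length (u ++ v)      ≡⟨ length-++ u ⟩
  length u + length v  ≡⟨ cong (_+ length v) |u|≡rank ⟩
  rank u x + length v  ≡⟨ rank-++-above u v (λ y∈v → v≪u y∈v x∈u) ⟨
  rank (u ++ v) x      ≤⟨ proj₂ (Equivalence.to (splits _) (∈-map⁺ (rank (u ++ v)) x∈take)) ⟩
  j                    ∎)
  where
  open ≤-Reasoning
  x∈take : x ∈ take j (u ++ v)
  x∈take = subst (x ∈_) (sym (take-++-≥ u v (<⇒≤ (≰⇒> j≰u)))) (∈-++⁺ˡ x∈u)

-- Indecomposable components

segment? : ∀ l j → Dec (∀ x → (x ∈ l) ⇔ (1 ≤ x × x ≤ j))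
segment? l j =
  map′ toSegment fromSegment
       (All.all? (λ x → (1 ≤? x) ×-dec (x ≤? j)) l
        ×-dec allUpTo? (λ x → (1 ≤? x) →-dec (x ∈? l)) (suc j))
  where
  Inside  = All.All (λ x → 1 ≤ x × x ≤ j) l
  Covered = ∀ {x} → x < suc j → 1 ≤ x → x ∈ l
  toSegment : Inside × Covered → ∀ x → (x ∈ l) ⇔ (1 ≤ x × x ≤ j)
  toSegment (inside , covered) x = mk⇔ (All.lookup inside) (λ (1≤x , x≤j) → covered (s≤s x≤j) 1≤x)
  fromSegment : (∀ x → (x ∈ l) ⇔ (1 ≤ x × x ≤ j)) → Inside × Covered
  fromSegment same = All.tabulate (Equivalence.to (same _)) ,
                     λ x<1+j 1≤x → Equivalence.from (same _) (1≤x , s≤s⁻¹ x<1+j)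

indecomposable? : ∀ w → Dec (Indecomposable w)
indecomposable? w =
  map′ (λ none j 1≤j j<w → none j<w 1≤j) (λ indec {j} j<w 1≤j → indec j 1≤j j<w)
       (allUpTo? (λ j → (1 ≤? j) →-dec ¬? (segment? (take j (reduce w)) j)) (length w))

greatest : ∀ {P : ℕ → Set} → Decidable P → ∀ {b m} → P b → b ≤′ m →
           Σ ℕ λ k → b ≤ k × k ≤ m × P k × (∀ k′ → k < k′ → k′ ≤ m → ¬ P k′)
greatest P? pb ≤′-refl = _ , ≤-refl , ≤-refl , pb , λ _ k<k′ k′≤k _ → <⇒≱ k<k′ k′≤k
greatest P? {m = suc m} pb (≤′-step b≤′m) with greatest P? pb b≤′m | P? (suc m)
... | _ | yes p = suc m , m≤n⇒m≤1+n (≤′⇒≤ b≤′m) , ≤-refl , p , λ _ m<k′ k′≤m _ → <⇒≱ m<k′ k′≤m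
... | k , b≤k , k≤m , pk , none | no ¬p = k , b≤k , m≤n⇒m≤1+n k≤m , pk , none′
  where
  none′ : ∀ k′ → k < k′ → k′ ≤ suc m → ¬ _
  none′ k′ k<k′ k′≤1+m with m≤n⇒m<n∨m≡n k′≤1+m
  ... | inj₁ k′<1+m = none k′ k<k′ (s≤s⁻¹ k′<1+m)
  ... | inj₂ refl   = ¬p

longestIndecPrefix : ∀ w → 1 ≤ length w → Σ (List ℕ) λ p → Σ (List ℕ) (LongestIndecPrefix w p)
longestIndecPrefix w 1≤w with greatest (indecomposable? ∘ flip take w) take1-indec (≤⇒≤′ 1≤w)
  where
  take1-indec : Indecomposable (take 1 w)
  take1-indec =
    Indecomposable-short (take 1 w) (subst (_≤ 1) (sym (length-take 1 w)) (m⊓n≤m 1 (length w)))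
... | k , 1≤k , k≤w , indec , longest = take k w , drop k w , record
  { split    = sym (take++drop≡id k w)
  ; nonempty = subst (1 ≤_) (sym |take|≡k) 1≤k
  ; indec    = indec
  ; longest  = λ k′ p<k′ → longest k′ (subst (_< k′) |take|≡k p<k′)
  }
  where
  |take|≡k : length (take k w) ≡ k
  |take|≡k = trans (length-take k w) (m≤n⇒m⊓n≡m k≤w)

rest-shorter : ∀ {w p rest} → LongestIndecPrefix w p rest → length rest < length w
rest-shorter {p = p} {rest} first =
  subst (length rest <_) (sym (trans (cong length split) (length-++ p))) (m<n+m (length rest) nonempty)
  where open LongestIndecPrefix first

components : ∀ w → Σ (List (List ℕ)) (Components w)
components w = go w (On.wellFounded length <-wellFounded w)
  where
  go : ∀ w → Acc (_<_ on length) w → Σ (List (List ℕ)) (Components w)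
  go []        _         = [] , done
  go w@(_ ∷ _) (acc rec) with longestIndecPrefix w (s≤s z≤n)
  ... | p , rest , first with go rest (rec (rest-shorter first))
  ...   | cs , C = p ∷ cs , next first C

components-++ : ∀ {u cs} → Components u cs → ∀ v → 1 ≤ length v → Indecomposable v → Unique u → u ≪ v →
                Components (u ++ v) (cs ++ v ∷ [])
components-++ done v 1≤v v-indec _ _ = next whole done
  where
  whole : LongestIndecPrefix v v []
  whole = record
    { split    = sym (++-identityʳ v)
    ; nonempty = 1≤v
    ; indec    = v-indec
    ; longest  = λ k v<k k≤v → contradiction k≤v (<⇒≱ v<k)
    }
components-++ {u} (next {p = p} {rest} first C) v 1≤v v-indec uu u≪v =
  next first′ (components-++ C v 1≤v v-indec (Unique-++ʳ p (subst Unique First.split uu)) rest≪v)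
  where
  module First = LongestIndecPrefix first
  rest≪v : rest ≪ v
  rest≪v x∈rest = u≪v (subst (_ ∈_) (sym First.split) (∈-++⁺ʳ p x∈rest))
  1≤u : 1 ≤ length u
  1≤u = subst (λ w → 1 ≤ length w) (sym First.split) (≤-trans First.nonempty (length-++-≤ˡ p))
  longest′ : ∀ k → length p < k → k ≤ length (u ++ v) → ¬ Indecomposable (take k (u ++ v))
  longest′ k p<k _ with k ≤? length u
  ... | yes k≤u rewrite take-++-≤ u v k≤u = First.longest k p<k k≤u
  ... | no k≰u rewrite take-++-≥ u v (<⇒≤ (≰⇒> k≰u)) =
    ¬Indecomposable-++-below u (take (k ∸ length u) v) 1≤u 1≤v′ uu
                             (λ x∈u y∈v′ → u≪v x∈u (∈-take⁻ _ v y∈v′))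
    where
    1≤v′ : 1 ≤ length (take (k ∸ length u) v)
    1≤v′ = subst (1 ≤_) (sym (length-take (k ∸ length u) v)) (⊓-glb (m<n⇒0<n∸m (≰⇒> k≰u)) 1≤v)
  first′ : LongestIndecPrefix (u ++ v) p (rest ++ v)
  first′ = record
    { split    = trans (cong (_++ v) First.split) (++-assoc p rest v)
    ; nonempty = First.nonempty
    ; indec    = First.indec
    ; longest  = longest′
    }

-- Left bracketing

Step : List Meld → List Meld → Set
Step ms ms′ = step ms ≡ just ms′

Run : List Meld → List Meld → Set
Run = Star Step

step-merge : ∀ m₁ m₂ {m} ms → merge? m₁ m₂ ≡ just m → Step (m₁ ∷ m₂ ∷ ms) (m ∷ ms)
step-merge m₁ m₂ ms merged rewrite merged = refl

step-skip : ∀ m₁ m₂ ms → merge? m₁ m₂ ≡ nothing →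
            step (m₁ ∷ m₂ ∷ ms) ≡ Maybe.map (m₁ ∷_) (step (m₂ ∷ ms))
step-skip m₁ m₂ ms unmerged rewrite unmerged = refl

step-length : ∀ ms {ms′} → Step ms ms′ → length ms ≡ suc (length ms′)
step-length (m₁ ∷ m₂ ∷ ms) s with merge? m₁ m₂ | step (m₂ ∷ ms) in s′
step-length (m₁ ∷ m₂ ∷ ms) refl | just _  | _        = refl
step-length (m₁ ∷ m₂ ∷ ms) refl | nothing | just ms′ = cong suc (step-length (m₂ ∷ ms) s′)

¬Step-[] : ∀ ms → ¬ Step ms []
¬Step-[] (m₁ ∷ m₂ ∷ ms) s = contradiction (step-length (m₁ ∷ m₂ ∷ ms) s) λ ()

Run-iterateSteps : ∀ k ms → Run ms (iterateSteps k ms)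
Run-iterateSteps zero    ms = ε
Run-iterateSteps (suc k) ms with step ms in s
... | nothing  = ε
... | just ms′ = s ◅ Run-iterateSteps k ms′

iterateSteps-reaches : ∀ {ms m} → Run ms (m ∷ []) → ∀ k → length ms ≤ k → iterateSteps k ms ≡ m ∷ []
iterateSteps-reaches ε            zero    _    = refl
iterateSteps-reaches ε            (suc k) _    = refl
iterateSteps-reaches {ms} (s ◅ r) zero    ms≤0 =
  contradiction (subst (_≤ 0) (step-length ms s) ms≤0) λ ()
iterateSteps-reaches {ms} (s ◅ r) (suc k) ms≤k rewrite s =
  iterateSteps-reaches r k (s≤s⁻¹ (subst (_≤ suc k) (step-length ms s) ms≤k))

Run-stuck : ∀ {ms ms′} → Run ms ms′ → step ms ≡ nothing → ms ≡ ms′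
Run-stuck ε       _     = refl
Run-stuck (s ◅ _) stuck = contradiction (trans (sym s) stuck) λ ()

data Merger (a b : Meld) : Meld → Set where
  asParen : suc (maxL (entries a)) ≡ minL (entries b) → Merger a b (paren a b)
  asBrack : minL (entries a) ≡ suc (maxL (entries b)) → Merger a b (brack a b)

merge?-merger : ∀ a b {m} → merge? a b ≡ just m → Merger a b m
merge?-merger a b merged
  with consecutive (entries a ++ entries b)
     | suc (maxL (entries a)) ≡ᵇ minL (entries b) in up
     | minL (entries a) ≡ᵇ suc (maxL (entries b)) in down
merge?-merger a b refl | true | true  | _    = asParen (≡ᵇ⇒≡ _ _ (Equivalence.from T-≡ up))
merge?-merger a b refl | true | false | true = asBrack (≡ᵇ⇒≡ _ _ (Equivalence.from T-≡ down))

merge?-paren : ∀ a b → consecutive (entries a ++ entries b) ≡ true →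
               suc (maxL (entries a)) ≡ minL (entries b) → merge? a b ≡ just (paren a b)
merge?-paren a b consec gap rewrite consec | Equivalence.to T-≡ (≡⇒≡ᵇ _ _ gap) = refl

merger-entries : ∀ {a b m} → Merger a b m → entries m ≡ entries a ++ entries b
merger-entries (asParen _) = refl
merger-entries (asBrack _) = refl

entries-nonempty : ∀ m → 1 ≤ length (entries m)
entries-nonempty (leaf _)    = s≤s z≤n
entries-nonempty (paren a _) = ≤-trans (entries-nonempty a) (length-++-≤ˡ (entries a))
entries-nonempty (brack a _) = ≤-trans (entries-nonempty a) (length-++-≤ˡ (entries a))

flat : List Meld → List ℕ
flat = concatMap entries

flat-++ : ∀ A B → flat (A ++ B) ≡ flat A ++ flat B
flat-++ A B = trans (cong concat (map-++ entries A B)) (sym (concat-++ (map entries A) (map entries B)))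

flat-leaves : ∀ w → flat (map leaf w) ≡ w
flat-leaves w = trans (concatMap-map entries leaf w) (concatMap-pure w)

step-flat : ∀ ms {ms′} → Step ms ms′ → flat ms ≡ flat ms′
step-flat (m₁ ∷ m₂ ∷ ms) s with merge? m₁ m₂ in merged | step (m₂ ∷ ms) in s′
step-flat (m₁ ∷ m₂ ∷ ms) refl | just m  | _ = begin
  entries m₁ ++ entries m₂ ++ flat ms    ≡⟨ ++-assoc (entries m₁) (entries m₂) (flat ms) ⟨
  (entries m₁ ++ entries m₂) ++ flat ms  ≡⟨ cong (_++ flat ms) (merger-entries merger) ⟨
  entries m ++ flat ms                   ∎
  where
  open ≡-Reasoning
  merger = merge?-merger m₁ m₂ merged
step-flat (m₁ ∷ m₂ ∷ ms) refl | nothing | just _ = cong (entries m₁ ++_) (step-flat (m₂ ∷ ms) s′)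

Run-flat : ∀ {ms ms′} → Run ms ms′ → flat ms ≡ flat ms′
Run-flat ε            = refl
Run-flat {ms} (s ◅ r) = trans (step-flat ms s) (Run-flat r)

leaves-++ : ∀ w A B → map leaf w ≡ A ++ B → B ≡ map leaf (flat B)
leaves-++ w       []      B eq =
  trans (sym eq) (cong (map leaf) (sym (trans (cong flat (sym eq)) (flat-leaves w))))
leaves-++ (x ∷ w) (_ ∷ A) B eq = leaves-++ w A B (∷-injectiveʳ eq)

data StepSplit (X A B : List Meld) : Set where
  inLeft  : ∀ A′ → X ≡ A′ ++ B → Step A′ A → StepSplit X A B
  inRight : ∀ B′ → X ≡ A ++ B′ → step A ≡ nothing → Step B′ B → StepSplit X A B

step-split : ∀ X A B → Step X (A ++ B) → StepSplit X A B
step-split X [] B s = inRight X refl refl s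
step-split (m₁ ∷ m₂ ∷ ms) (a ∷ A) B s with merge? m₁ m₂ in merged | step (m₂ ∷ ms) in s′
step-split (m₁ ∷ m₂ ∷ ms) (a ∷ A) B refl | just _ | _ =
  inLeft (m₁ ∷ m₂ ∷ A) refl (step-merge m₁ m₂ A merged)
step-split (m₁ ∷ m₂ ∷ ms) (a ∷ A) B refl | nothing | just _ with step-split (m₂ ∷ ms) A B s′
... | inLeft (_ ∷ A′) refl sA =
  inLeft (m₁ ∷ m₂ ∷ A′) refl (trans (step-skip m₁ m₂ A′ merged) (cong (Maybe.map (m₁ ∷_)) sA))
... | inRight B′ eq stuck sB = inRight B′ (cong (m₁ ∷_) eq) (stuck-∷ A eq stuck) sB
  where
  stuck-∷ : ∀ A → m₂ ∷ ms ≡ A ++ B′ → step A ≡ nothing → step (m₁ ∷ A) ≡ nothing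
  stuck-∷ []      _    _      = refl
  stuck-∷ (_ ∷ A) refl stuckA = trans (step-skip m₁ m₂ A merged) (cong (Maybe.map (m₁ ∷_)) stuckA)

CompletedAfter : List Meld → List Meld → List Meld → Set
CompletedAfter A Sʳ B = Sʳ ≡ B ⊎ Σ (List Meld) λ B′ → Step B′ B × Step (A ++ B′) (A ++ B)

record RunSplit (S A B : List Meld) : Set where
  field
    Sˡ Sʳ     : List Meld
    split     : S ≡ Sˡ ++ Sʳ
    runˡ      : Run Sˡ A
    runʳ      : Run Sʳ B
    completed : CompletedAfter A Sʳ B

Run-split : ∀ {S} A B → Run S (A ++ B) → RunSplit S A B
Run-split A B ε = record { Sˡ = A ; Sʳ = B ; split = refl ; runˡ = ε ; runʳ = ε ; completed = inj₁ refl }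
Run-split {S} A B (s ◅ r) with Run-split A B r
... | record { Sˡ = A₁ ; Sʳ = B₁ ; split = refl ; runˡ = rA ; runʳ = rB ; completed = after₁ }
    with step-split S A₁ B₁ s
...   | inLeft A′ refl sA =
  record { Sˡ = A′ ; Sʳ = B₁ ; split = refl ; runˡ = sA ◅ rA ; runʳ = rB ; completed = after₁ }
...   | inRight B′ refl stuck sB =
  record { Sˡ = A₁ ; Sʳ = B′ ; split = refl ; runˡ = rA ; runʳ = sB ◅ rB ; completed = after′ after₁ }
  where
  after′ : CompletedAfter A B₁ B → CompletedAfter A B′ B
  after′ (inj₂ earlier) = inj₂ earlier
  after′ (inj₁ refl) with Run-stuck rA stuck
  ... | refl = inj₂ (B′ , sB , s)

Run-last : ∀ {S M} → Run S (M ∷ []) → S ≡ M ∷ [] ⊎ Σ (List Meld) λ X → Run S X × Step X (M ∷ [])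
Run-last ε = inj₁ refl
Run-last (s ◅ r) with Run-last r
... | inj₁ refl          = inj₂ (_ , ε , s)
... | inj₂ (X , r′ , s′) = inj₂ (X , s ◅ r′ , s′)

step-pair : ∀ X {M} → Step X (M ∷ []) → Σ Meld λ a → Σ Meld λ b → X ≡ a ∷ b ∷ [] × merge? a b ≡ just M
step-pair (m₁ ∷ m₂ ∷ ms) s with merge? m₁ m₂ in merged | step (m₂ ∷ ms) in s′
step-pair (m₁ ∷ m₂ ∷ []) refl | just _  | _       = m₁ , m₂ , refl , merged
step-pair (m₁ ∷ m₂ ∷ ms) refl | nothing | just [] = contradiction s′ (¬Step-[] (m₂ ∷ ms))

step-keeps-head : ∀ m₁ m₂ {ms ms′} → Step (m₁ ∷ m₂ ∷ ms) (m₁ ∷ ms′) → merge? m₁ m₂ ≡ nothing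
step-keeps-head m₁ m₂ s with merge? m₁ m₂ in merged
... | nothing = refl
... | just _ with merge?-merger m₁ m₂ merged | s
...   | asParen _ | ()
...   | asBrack _ | ()

CompletedRightOf : Meld → Meld → Set
CompletedRightOf a b =
  length (entries b) ≡ 1 ⊎ Σ Meld λ a′ → Σ Meld λ b′ → Merger a′ b′ b × merge? a a′ ≡ nothing

record TopMerger (w : List ℕ) (M : Meld) : Set where
  field
    a b       : Meld
    merger    : Merger a b M
    word      : w ≡ entries a ++ entries b
    bracketsʳ : leftBracketing (entries b) ≡ b ∷ []
    completed : CompletedRightOf a b

topMerger : ∀ w {M} → 2 ≤ length w → leftBracketing w ≡ M ∷ [] → TopMerger w M
topMerger w 2≤w lb with Run-last (subst (Run (map leaf w)) lb (Run-iterateSteps (length w) (map leaf w)))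
... | inj₁ single =
  contradiction (subst (2 ≤_) (trans (sym (length-map leaf w)) (cong length single)) 2≤w) λ { (s≤s ()) }
... | inj₂ (X , r , s) with step-pair X s
... | a , b , refl , merged with Run-split (a ∷ []) (b ∷ []) r
... | record { Sˡ = A₀ ; Sʳ = B₀ ; split = split ; runˡ = rA ; runʳ = rB ; completed = afterA } = record
  { a         = a
  ; b         = b
  ; merger    = merge?-merger a b merged
  ; word      = word
  ; bracketsʳ = iterateSteps-reaches (subst (λ B → Run B (b ∷ [])) B₀≡leaves rB) (length (entries b))
                                     (≤-reflexive (length-map leaf (entries b)))
  ; completed = completedʳ afterA
  }
  where
  flatˡ : flat A₀ ≡ entries a
  flatˡ = trans (Run-flat rA) (++-identityʳ (entries a))
  flatʳ : flat B₀ ≡ entries b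
  flatʳ = trans (Run-flat rB) (++-identityʳ (entries b))
  word : w ≡ entries a ++ entries b
  word = begin
    w                       ≡⟨ flat-leaves w ⟨
    flat (map leaf w)       ≡⟨ cong flat split ⟩
    flat (A₀ ++ B₀)         ≡⟨ flat-++ A₀ B₀ ⟩
    flat A₀ ++ flat B₀      ≡⟨ cong₂ _++_ flatˡ flatʳ ⟩
    entries a ++ entries b  ∎
    where open ≡-Reasoning
  B₀≡leaves : B₀ ≡ map leaf (entries b)
  B₀≡leaves = trans (leaves-++ w A₀ B₀ split) (cong (map leaf) flatʳ)
  completedʳ : CompletedAfter (a ∷ []) B₀ (b ∷ []) → CompletedRightOf a b
  completedʳ (inj₁ B₀≡b) =
    inj₁ (trans (sym (length-map leaf (entries b))) (cong length (trans (sym B₀≡leaves) B₀≡b)))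
  completedʳ (inj₂ (B′ , sB , sAB)) with step-pair B′ sB
  ... | a′ , b′ , refl , merged′ =
    inj₂ (a′ , b′ , merge?-merger a′ b′ merged′ , step-keeps-head a a′ sAB)

right-indecomposable : ∀ a b → Convex (entries a ++ entries b) → Unique (entries b) →
                       suc (maxL (entries a)) ≡ minL (entries b) → CompletedRightOf a b →
                       Indecomposable (entries b)
right-indecomposable a b _ _ _ (inj₁ single) = Indecomposable-short (entries b) (≤-reflexive single)
right-indecomposable a _ _ ub _ (inj₂ (a′ , b′ , asBrack gap′ , _)) =
  Indecomposable-++-above (entries a′) (entries b′) (entries-nonempty a′) (entries-nonempty b′)
                          (Unique-++ˡ (entries a′) ub) (≪-from-gap (entries b′) (entries a′) (sym gap′))
right-indecomposable a _ conv _ gap (inj₂ (a′ , b′ , asParen gap′ , unmerged)) =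
  contradiction (trans (sym (merge?-paren a a′ consec gapˡ)) unmerged) λ ()
  where
  ea  = entries a
  ea′ = entries a′
  eb′ = entries b′
  a′≪b′ : ea′ ≪ eb′
  a′≪b′ = ≪-from-gap ea′ eb′ gap′
  gapˡ : suc (maxL ea) ≡ minL ea′
  gapˡ = trans gap (minL-++-≪ ea′ eb′ (entries-nonempty a′) a′≪b′)
  aa′≪b′ : ea ++ ea′ ≪ eb′
  aa′≪b′ = ≪-++ˡ ea ea′ (λ x∈ y∈ → ≪-from-gap ea (ea′ ++ eb′) gap x∈ (∈-++⁺ʳ ea′ y∈)) a′≪b′
  consec : consecutive (ea ++ ea′) ≡ true
  consec = consecutive-convex (ea ++ ea′) (≤-trans (entries-nonempty a) (length-++-≤ˡ ea))
             (Convex-++ˡ (ea ++ ea′) eb′ (subst Convex (sym (++-assoc ea ea′ eb′)) conv) aa′≪b′)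

theorem4p8 : (n : ℕ) (π : List ℕ) → π ↭ oneTo n → 2 ≤ n → Full n π →
    (M : Meld) → leftBracketing π ≡ M ∷ [] →
    (Σ Meld λ m₁ → Σ Meld λ m₂ → M ≡ brack m₁ m₂ × Indecomposable π)
    ⊎ (¬ Indecomposable π
       × Σ Meld λ m₁ → Σ Meld λ m₂ → M ≡ paren m₁ m₂
         × Σ (List (List ℕ)) λ cs → Components π (cs ++ (entries m₂ ∷ []))
         × leftBracketing (entries m₂) ≡ m₂ ∷ [])
theorem4p8 n π π↭ 2≤n _ M lb
  with topMerger π (subst (2 ≤_) (sym (trans (↭-length π↭) (length-oneTo n))) 2≤n) lb
... | record { a = a ; b = b ; merger = asBrack gap ; word = refl } =
  inj₁ (a , b , refl , Indecomposable-++-above ea eb (entries-nonempty a) (entries-nonempty b) ua b≪a)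
  where
  ea = entries a
  eb = entries b
  ua = Unique-++ˡ ea (Unique-resp-↭ (↭-sym π↭) (Unique-oneTo n))
  b≪a = ≪-from-gap eb ea (sym gap)
... | record { a = a ; b = b ; merger = asParen gap ; word = refl
             ; bracketsʳ = bracketsʳ ; completed = rightOf } =
  let cs , C = components ea in
  inj₂ ( ¬Indecomposable-++-below ea eb (entries-nonempty a) (entries-nonempty b) ua a≪b
       , a , b , refl , cs , components-++ C eb (entries-nonempty b) b-indec ua a≪b , bracketsʳ )
  where
  ea = entries a
  eb = entries b
  uπ = Unique-resp-↭ (↭-sym π↭) (Unique-oneTo n)
  ua = Unique-++ˡ ea uπ
  a≪b = ≪-from-gap ea eb gap
  b-indec = right-indecomposable a b (Convex-resp-↭ π↭ (Convex-oneTo n)) (Unique-++ʳ ea uπ) gap rightOf
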